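{- Let $s_{n,k}$ $(n,k\ge 0)$ be the Sulanke numbers. Then for all $n,k\ge 0$, $$s_{n,k}=\begin{cases}\binom{\frac{n+k}{2},\,\frac{n+k}{2}}{k,\,2}, & \text{if } n+k \text{ is even},\\[4pt] \binom{\frac{n+k-1}{2},\,\frac{n+k+1}{2}}{k,\,2}, & \text{if } n+k \text{ is odd}.\end{cases}$$
   Context: The Sulanke numbers are defined by $s_{0,0}=1$, $s_{n,k}=0$ if $n<0$ or $k<0$, and for $(n,k)\ne(0,0)$ with $n,k\ge0$: $s_{n,k}=s_{n,k-1}+s_{n-1,k}$ if $n+k$ is even, and $s_{n,k}=s_{n,k-1}+2s_{n-1,k}$ if $n+k$ is odd. For nonnegative integers $m,n$ and a positive integer $q$, let $X$ be a set which is the disjoint union of $n$ "main blocks" each of size $q$ and an "additional block" of size $m$. An $(n+k)$-inset of $X$ is an $(n+k)$-element subset of $X$ that intersects every main block; their number is denoted $\binom{m,n}{k,q}$ (for $n=0$ this is the ordinary binomial coefficient $\binom{m}{k}$). -}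

module Defs where

open import Data.Nat using (ℕ; zero; suc; _+_; _*_)
open import Data.Bool using (Bool; true; false; if_then_else_)
open import Data.List using (List; []; _∷_; map; _++_; length; filter; cartesianProduct)
open import Data.Vec using (Vec; []; _∷_)
open import Data.Vec.Relation.Unary.All using (All; all?)
open import Data.Product using (_×_; _,_; proj₁; proj₂)
open import Data.Fin.Subset using (Subset; Nonempty; ∣_∣)
open import Data.Fin.Subset.Properties using (nonempty?)
open import Relation.Binary.PropositionalEquality using (_≡_)
open import Relation.Nullary using (Dec)
open import Relation.Nullary.Decidable using (_×-dec_)
open import Data.Nat.Properties using (_≟_)

evenᵇ : ℕ → Bool
evenᵇ zero = true
evenᵇ (suc zero) = false
evenᵇ (suc (suc n)) = evenᵇ n

-- Sulanke numbers s n k.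
-- s_{n,k} = s_{n,k-1} + w * s_{n-1,k}, with w = 1 if n+k even, w = 2 if n+k odd,
-- and terms with a negative index equal 0.
sulanke : ℕ → ℕ → ℕ
sulanke zero zero = 1
sulanke zero (suc k) = sulanke zero k
sulanke (suc n) zero = (if evenᵇ (suc n) then 1 else 2) * sulanke n zero
sulanke (suc n) (suc k) =
  sulanke (suc n) k + (if evenᵇ (suc n + suc k) then 1 else 2) * sulanke n (suc k)

allSubsets : (l : ℕ) → List (Subset l)
allSubsets zero = [] ∷ []
allSubsets (suc l) = map (true ∷_) (allSubsets l) ++ map (false ∷_) (allSubsets l)

allVecs : {A : Set} → List A → (n : ℕ) → List (Vec A n)
allVecs xs zero = [] ∷ []
allVecs xs (suc n) = map (λ p → proj₁ p ∷ proj₂ p) (cartesianProduct xs (allVecs xs n))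

-- A subset of X = (n main blocks of size q) ⊔ (additional block of size m),
-- given by its intersection with each main block and with the additional block.
SubsetX : (m n q : ℕ) → Set
SubsetX m n q = Vec (Subset q) n × Subset m

allSubsetsX : (m n q : ℕ) → List (SubsetX m n q)
allSubsetsX m n q = cartesianProduct (allVecs (allSubsets q) n) (allSubsets m)

sumSizes : {n q : ℕ} → Vec (Subset q) n → ℕ
sumSizes [] = 0
sumSizes (b ∷ bs) = ∣ b ∣ + sumSizes bs

sizeX : {m n q : ℕ} → SubsetX m n q → ℕ
sizeX (bs , a) = sumSizes bs + ∣ a ∣

IsInset : (m n k q : ℕ) → SubsetX m n q → Set
IsInset m n k q S = (sizeX S ≡ n + k) × All Nonempty (proj₁ S)

isInset? : (m n k q : ℕ) → (S : SubsetX m n q) → Dec (IsInset m n k q S)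
isInset? m n k q S = (sizeX S ≟ n + k) ×-dec all? nonempty? (proj₁ S)

-- the number of (n+k)-insets of X, written binom{m,n}{k,q} in the paper
insets : (m n k q : ℕ) → ℕ
insets m n k q = length (filter (isInset? m n k q) (allSubsetsX m n q))

module Submission where

-- Split the (n+k)-insets of X either by whether they contain a fixed element of the
-- additional block, or by their intersection with a fixed main block of size 2 (the
-- whole block, or one of its two singletons):
--   insets (m+1) n (k+1) q = insets m n k q + insets m n (k+1) q,
--   insets m (n+1) (k+1) 2 = insets m n k 2 + 2 · insets m n (k+1) 2.
-- With ⌈(n+k)/2⌉ main blocks and ⌊(n+k)/2⌋ additional elements these are the Sulanke
-- recurrences of weight 1 (n+k even) and weight 2 (n+k odd). On the boundary the
-- missing Sulanke terms correspond to inset numbers that vanish because an inset has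
-- at least one element per main block and at most |X| elements.

open import Defs
open import Data.Bool using (Bool; true; false; not; if_then_else_; _∧_)
open import Data.Bool.Properties using (∧-zeroʳ)
open import Data.Fin.Subset using (Subset; Nonempty; ∣_∣; inside; outside)
open import Data.Fin.Subset.Properties using (nonempty?; ∣p∣≤n; x∈p⇒∣p-x∣<∣p∣)
open import Data.List using (List; []; _∷_; map; _++_; length; filter; cartesianProduct)
open import Data.List.Properties using (map-++; map-∘; ++-assoc)
open import Data.Nat using (ℕ; zero; suc; _+_; _*_; _<_; _≤_; z≤n)
open import Data.Nat.ListAction using (sum)
open import Data.Nat.Properties
open import Algebra.Properties.CommutativeSemigroup +-commutativeSemigroup using (interchange)
open import Data.Nat.Tactic.RingSolver using (solve-∀)
open import Data.Product using (_×_; _,_; proj₁; proj₂; map₁; map₂)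
open import Data.Vec using (Vec; []; _∷_)
open import Data.Vec.Relation.Unary.All using (All; []; _∷_; all?)
open import Function using (_∘_)
open import Relation.Binary.PropositionalEquality
open import Relation.Nullary using (does; yes; no; contradiction)
open import Relation.Nullary.Decidable using (dec-false)
open import Relation.Unary using (Pred; Decidable)

private variable
  A B C : Set
  m n q t : ℕ

count : (A → Bool) → List A → ℕ
count p []       = 0
count p (x ∷ xs) = if p x then suc (count p xs) else count p xs

length-filter≡count : ∀ {ℓ} {P : Pred A ℓ} (P? : Decidable P) (xs : List A) →
                      length (filter P? xs) ≡ count (does ∘ P?) xs
length-filter≡count P? []       = refl
length-filter≡count P? (x ∷ xs) with does (P? x)
... | true  = cong suc (length-filter≡count P? xs)
... | false = length-filter≡count P? xs

count-++ : (p : A → Bool) (xs ys : List A) → count p (xs ++ ys) ≡ count p xs + count p ys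
count-++ p []       ys = refl
count-++ p (x ∷ xs) ys with p x
... | true  = cong suc (count-++ p xs ys)
... | false = count-++ p xs ys

count-map : (p : B → Bool) (f : A → B) (xs : List A) → count p (map f xs) ≡ count (p ∘ f) xs
count-map p f []       = refl
count-map p f (x ∷ xs) with p (f x)
... | true  = cong suc (count-map p f xs)
... | false = count-map p f xs

count-cong : {p p′ : A → Bool} → (∀ x → p x ≡ p′ x) → (xs : List A) → count p xs ≡ count p′ xs
count-cong p≗p′ []       = refl
count-cong {p = p} {p′} p≗p′ (x ∷ xs) rewrite p≗p′ x with p′ x
... | true  = cong suc (count-cong p≗p′ xs)
... | false = count-cong p≗p′ xs

count-none : {p : A → Bool} → (∀ x → p x ≡ false) → (xs : List A) → count p xs ≡ 0
count-none p≗false []       = refl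
count-none p≗false (x ∷ xs) rewrite p≗false x = count-none p≗false xs

cartesianProduct-++ˡ : (xs ws : List A) (ys : List B) →
  cartesianProduct (xs ++ ws) ys ≡ cartesianProduct xs ys ++ cartesianProduct ws ys
cartesianProduct-++ˡ []       ws ys = refl
cartesianProduct-++ˡ (x ∷ xs) ws ys =
  trans (cong (map (x ,_) ys ++_) (cartesianProduct-++ˡ xs ws ys))
        (sym (++-assoc (map (x ,_) ys) _ _))

cartesianProduct-mapˡ : (f : A → C) (xs : List A) (ys : List B) →
  cartesianProduct (map f xs) ys ≡ map (map₁ f) (cartesianProduct xs ys)
cartesianProduct-mapˡ f []       ys = refl
cartesianProduct-mapˡ f (x ∷ xs) ys = begin
  map (f x ,_) ys ++ cartesianProduct (map f xs) ys
    ≡⟨ cong₂ _++_ (map-∘ ys) (cartesianProduct-mapˡ f xs ys) ⟩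
  map (map₁ f) (map (x ,_) ys) ++ map (map₁ f) (cartesianProduct xs ys)
    ≡⟨ map-++ (map₁ f) (map (x ,_) ys) _ ⟨
  map (map₁ f) (map (x ,_) ys ++ cartesianProduct xs ys) ∎
  where open ≡-Reasoning

cartesianProduct-mapʳ : (f : B → C) (xs : List A) (ys : List B) →
  cartesianProduct xs (map f ys) ≡ map (map₂ f) (cartesianProduct xs ys)
cartesianProduct-mapʳ f []       ys = refl
cartesianProduct-mapʳ f (x ∷ xs) ys = begin
  map (x ,_) (map f ys) ++ cartesianProduct xs (map f ys)
    ≡⟨ cong₂ _++_ (sym (map-∘ ys)) (cartesianProduct-mapʳ f xs ys) ⟩
  map ((x ,_) ∘ f) ys ++ map (map₂ f) (cartesianProduct xs ys)
    ≡⟨ cong (_++ _) (map-∘ ys) ⟩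
  map (map₂ f) (map (x ,_) ys) ++ map (map₂ f) (cartesianProduct xs ys)
    ≡⟨ map-++ (map₂ f) (map (x ,_) ys) _ ⟨
  map (map₂ f) (map (x ,_) ys ++ cartesianProduct xs ys) ∎
  where open ≡-Reasoning

count-cartesianProduct-mapˡ : (p : C × B → Bool) (f : A → C) (xs : List A) (ys : List B) →
  count p (cartesianProduct (map f xs) ys) ≡ count (p ∘ map₁ f) (cartesianProduct xs ys)
count-cartesianProduct-mapˡ p f xs ys =
  trans (cong (count p) (cartesianProduct-mapˡ f xs ys)) (count-map p (map₁ f) (cartesianProduct xs ys))

count-cartesianProduct-mapʳ : (p : A × C → Bool) (f : B → C) (xs : List A) (ys : List B) →
  count p (cartesianProduct xs (map f ys)) ≡ count (p ∘ map₂ f) (cartesianProduct xs ys)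
count-cartesianProduct-mapʳ p f xs ys =
  trans (cong (count p) (cartesianProduct-mapʳ f xs ys)) (count-map p (map₂ f) (cartesianProduct xs ys))

count-cartesianProduct-++ʳ : (p : A × B → Bool) (xs : List A) (ys zs : List B) →
  count p (cartesianProduct xs (ys ++ zs))
  ≡ count p (cartesianProduct xs ys) + count p (cartesianProduct xs zs)
count-cartesianProduct-++ʳ p []       ys zs = refl
count-cartesianProduct-++ʳ p (x ∷ xs) ys zs = begin
  count p (map (x ,_) (ys ++ zs) ++ cartesianProduct xs (ys ++ zs))
    ≡⟨ count-++ p (map (x ,_) (ys ++ zs)) _ ⟩
  count p (map (x ,_) (ys ++ zs)) + count p (cartesianProduct xs (ys ++ zs))
    ≡⟨ cong₂ _+_ (trans (cong (count p) (map-++ (x ,_) ys zs)) (count-++ p (map (x ,_) ys) _))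
                 (count-cartesianProduct-++ʳ p xs ys zs) ⟩
  (count p (map (x ,_) ys) + count p (map (x ,_) zs))
    + (count p (cartesianProduct xs ys) + count p (cartesianProduct xs zs))
    ≡⟨ interchange (count p (map (x ,_) ys)) (count p (map (x ,_) zs))
                   (count p (cartesianProduct xs ys)) (count p (cartesianProduct xs zs)) ⟩
  (count p (map (x ,_) ys) + count p (cartesianProduct xs ys))
    + (count p (map (x ,_) zs) + count p (cartesianProduct xs zs))
    ≡⟨ cong₂ _+_ (count-++ p (map (x ,_) ys) _) (count-++ p (map (x ,_) zs) _) ⟨
  count p (map (x ,_) ys ++ cartesianProduct xs ys) + count p (map (x ,_) zs ++ cartesianProduct xs zs) ∎
  where open ≡-Reasoning

count-cartesianProduct-cartesianProductˡ : (p : (A × B) × C → Bool) (xs : List A) (ys : List B) (zs : List C) →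
  count p (cartesianProduct (cartesianProduct xs ys) zs)
  ≡ sum (map (λ x → count (p ∘ map₁ (x ,_)) (cartesianProduct ys zs)) xs)
count-cartesianProduct-cartesianProductˡ p []       ys zs = refl
count-cartesianProduct-cartesianProductˡ p (x ∷ xs) ys zs = begin
  count p (cartesianProduct (map (x ,_) ys ++ cartesianProduct xs ys) zs)
    ≡⟨ cong (count p) (cartesianProduct-++ˡ (map (x ,_) ys) _ zs) ⟩
  count p (cartesianProduct (map (x ,_) ys) zs ++ cartesianProduct (cartesianProduct xs ys) zs)
    ≡⟨ count-++ p (cartesianProduct (map (x ,_) ys) zs) _ ⟩
  count p (cartesianProduct (map (x ,_) ys) zs) + count p (cartesianProduct (cartesianProduct xs ys) zs)
    ≡⟨ cong₂ _+_ (count-cartesianProduct-mapˡ p (x ,_) ys zs)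
                 (count-cartesianProduct-cartesianProductˡ p xs ys zs) ⟩
  count (p ∘ map₁ (x ,_)) (cartesianProduct ys zs)
    + sum (map (λ x → count (p ∘ map₁ (x ,_)) (cartesianProduct ys zs)) xs) ∎
  where open ≡-Reasoning

isInsetOfSize : ℕ → SubsetX m n q → Bool
isInsetOfSize t S = does (sizeX S ≟ t) ∧ does (all? nonempty? (proj₁ S))

insetsOfSize : (m n q t : ℕ) → ℕ
insetsOfSize m n q t = count (isInsetOfSize t) (allSubsetsX m n q)

insets≡insetsOfSize : ∀ m n k q → insets m n k q ≡ insetsOfSize m n q (n + k)
insets≡insetsOfSize m n k q = length-filter≡count (isInset? m n k q) (allSubsetsX m n q)

nonempty⇒∣p∣>0 : {p : Subset q} → Nonempty p → 0 < ∣ p ∣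
nonempty⇒∣p∣>0 (x , x∈p) = ≤-<-trans z≤n (x∈p⇒∣p-x∣<∣p∣ x∈p)

all-nonempty⇒n≤sumSizes : {bs : Vec (Subset q) n} → All Nonempty bs → n ≤ sumSizes bs
all-nonempty⇒n≤sumSizes []         = z≤n
all-nonempty⇒n≤sumSizes (ne ∷ nes) = +-mono-≤ (nonempty⇒∣p∣>0 ne) (all-nonempty⇒n≤sumSizes nes)

sumSizes≤n*q : (bs : Vec (Subset q) n) → sumSizes bs ≤ n * q
sumSizes≤n*q []       = z≤n
sumSizes≤n*q (b ∷ bs) = +-mono-≤ (∣p∣≤n b) (sumSizes≤n*q bs)

sizeX≤n*q+m : (S : SubsetX m n q) → sizeX S ≤ n * q + m
sizeX≤n*q+m (bs , a) = +-mono-≤ (sumSizes≤n*q bs) (∣p∣≤n a)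

insetsOfSize-below : ∀ m q → t < n → insetsOfSize m n q t ≡ 0
insetsOfSize-below {t} {n} m q t<n = count-none tooSmall (allSubsetsX m n q)
  where
  tooSmall : (S : SubsetX m n q) → isInsetOfSize t S ≡ false
  tooSmall (bs , a) with all? nonempty? bs
  ... | yes ne = cong (_∧ true) (dec-false (sizeX (bs , a) ≟ t) λ size≡t →
                   <⇒≱ t<n (subst (_ ≤_) size≡t (≤-trans (all-nonempty⇒n≤sumSizes ne) (m≤m+n _ _))))
  ... | no _   = ∧-zeroʳ _

insetsOfSize-above : ∀ m n q → n * q + m < t → insetsOfSize m n q t ≡ 0
insetsOfSize-above {t} m n q n*q+m<t = count-none tooLarge (allSubsetsX m n q)
  where
  tooLarge : (S : SubsetX m n q) → isInsetOfSize t S ≡ false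
  tooLarge S = cong (_∧ does (all? nonempty? (proj₁ S))) (dec-false (sizeX S ≟ t) λ size≡t →
                 <⇒≱ n*q+m<t (subst (_≤ _) size≡t (sizeX≤n*q+m S)))

insetsOfSize-sucᵐ : ∀ m n q t → insetsOfSize (suc m) n q t
  ≡ count (isInsetOfSize t ∘ map₂ (inside ∷_)) (allSubsetsX m n q) + insetsOfSize m n q t
insetsOfSize-sucᵐ m n q t =
  trans (count-cartesianProduct-++ʳ (isInsetOfSize t) vs (map (inside ∷_) as) (map (outside ∷_) as))
        (cong₂ _+_ (count-cartesianProduct-mapʳ (isInsetOfSize t) (inside ∷_) vs as)
                   (count-cartesianProduct-mapʳ (isInsetOfSize t) (outside ∷_) vs as))
  where
  vs = allVecs (allSubsets q) n
  as = allSubsets m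

isInsetOfSize-inside : (S : SubsetX m n q) → isInsetOfSize (suc t) (map₂ (inside ∷_) S) ≡ isInsetOfSize t S
isInsetOfSize-inside (bs , a) rewrite +-suc (sumSizes bs) ∣ a ∣ = refl

isInsetOfSize-inside₀ : (S : SubsetX m n q) → isInsetOfSize 0 (map₂ (inside ∷_) S) ≡ false
isInsetOfSize-inside₀ (bs , a) rewrite +-suc (sumSizes bs) ∣ a ∣ = refl

insetsOfSize-sucᵐ-zero : ∀ m n q → insetsOfSize (suc m) n q 0 ≡ insetsOfSize m n q 0
insetsOfSize-sucᵐ-zero m n q =
  trans (insetsOfSize-sucᵐ m n q 0) (cong (_+ insetsOfSize m n q 0) (count-none isInsetOfSize-inside₀ (allSubsetsX m n q)))

insetsOfSize-sucᵐ-suc : ∀ m n q t →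
  insetsOfSize (suc m) n q (suc t) ≡ insetsOfSize m n q t + insetsOfSize m n q (suc t)
insetsOfSize-sucᵐ-suc m n q t =
  trans (insetsOfSize-sucᵐ m n q (suc t)) (cong (_+ insetsOfSize m n q (suc t)) (count-cong isInsetOfSize-inside (allSubsetsX m n q)))

insetsOfSize-sucⁿ : ∀ m n q t → insetsOfSize m (suc n) q t
  ≡ sum (map (λ b → count (isInsetOfSize t ∘ map₁ (b ∷_)) (allSubsetsX m n q)) (allSubsets q))
insetsOfSize-sucⁿ m n q t =
  trans (count-cartesianProduct-mapˡ (isInsetOfSize t) (λ p → proj₁ p ∷ proj₂ p) bvs as)
        (count-cartesianProduct-cartesianProductˡ _ (allSubsets q) (allVecs (allSubsets q) n) as)
  where
  bvs = cartesianProduct (allSubsets q) (allVecs (allSubsets q) n)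
  as = allSubsets m

-- The four intersections with the first block: full, two singletons, empty (excluded).
insetsOfSize-sucⁿ-one : ∀ m n → insetsOfSize m (suc n) 2 1 ≡ 2 * insetsOfSize m n 2 0
insetsOfSize-sucⁿ-one m n =
  trans (insetsOfSize-sucⁿ m n 2 1)
        (cong₂ (λ full empty → full + (insetsOfSize m n 2 0 + (insetsOfSize m n 2 0 + (empty + 0))))
               (count-none (λ _ → refl) (allSubsetsX m n 2))
               (count-none (λ _ → ∧-zeroʳ _) (allSubsetsX m n 2)))

insetsOfSize-sucⁿ-suc-suc : ∀ m n t →
  insetsOfSize m (suc n) 2 (suc (suc t)) ≡ insetsOfSize m n 2 t + 2 * insetsOfSize m n 2 (suc t)
insetsOfSize-sucⁿ-suc-suc m n t =
  trans (insetsOfSize-sucⁿ m n 2 (suc (suc t)))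
        (cong (λ empty → insetsOfSize m n 2 t + (insetsOfSize m n 2 (suc t) + (insetsOfSize m n 2 (suc t) + (empty + 0))))
              (count-none (λ _ → ∧-zeroʳ _) (allSubsetsX m n 2)))

insets-zero : ∀ m n q → insets m n 0 q ≡ insetsOfSize m n q n
insets-zero m n q = trans (insets≡insetsOfSize m n 0 q) (cong (insetsOfSize m n q) (+-identityʳ n))

insets-suc : ∀ m n k q → insets m n (suc k) q ≡ insetsOfSize m n q (suc (n + k))
insets-suc m n k q = trans (insets≡insetsOfSize m n (suc k) q) (cong (insetsOfSize m n q) (+-suc n k))

insets-pascal : ∀ m n k q → insets (suc m) n (suc k) q ≡ insets m n k q + insets m n (suc k) q
insets-pascal m n k q = begin
  insets (suc m) n (suc k) q                                  ≡⟨ insets-suc (suc m) n k q ⟩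
  insetsOfSize (suc m) n q (suc (n + k))                      ≡⟨ insetsOfSize-sucᵐ-suc m n q (n + k) ⟩
  insetsOfSize m n q (n + k) + insetsOfSize m n q (suc (n + k)) ≡⟨ cong₂ _+_ (insets≡insetsOfSize m n k q) (insets-suc m n k q) ⟨
  insets m n k q + insets m n (suc k) q                       ∎
  where open ≡-Reasoning

insets-pascal-zero : ∀ m n q → insets (suc m) n 0 q ≡ insets m n 0 q
insets-pascal-zero m n q = begin
  insets (suc m) n 0 q              ≡⟨ insets-zero (suc m) n q ⟩
  insetsOfSize (suc m) n q n        ≡⟨ diagonal n ⟩
  insetsOfSize m n q n              ≡⟨ insets-zero m n q ⟨
  insets m n 0 q                    ∎
  where
  open ≡-Reasoning
  diagonal : ∀ n → insetsOfSize (suc m) n q n ≡ insetsOfSize m n q n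
  diagonal zero    = insetsOfSize-sucᵐ-zero m 0 q
  diagonal (suc n) = trans (insetsOfSize-sucᵐ-suc m (suc n) q n)
                           (cong (_+ insetsOfSize m (suc n) q (suc n)) (insetsOfSize-below m q (n<1+n n)))

insets-block : ∀ m n k → insets m (suc n) (suc k) 2 ≡ insets m n k 2 + 2 * insets m n (suc k) 2
insets-block m n k = begin
  insets m (suc n) (suc k) 2                                      ≡⟨ insets-suc m (suc n) k 2 ⟩
  insetsOfSize m (suc n) 2 (suc (suc (n + k)))                    ≡⟨ insetsOfSize-sucⁿ-suc-suc m n (n + k) ⟩
  insetsOfSize m n 2 (n + k) + 2 * insetsOfSize m n 2 (suc (n + k)) ≡⟨ cong₂ (λ a b → a + 2 * b) (insets≡insetsOfSize m n k 2) (insets-suc m n k 2) ⟨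
  insets m n k 2 + 2 * insets m n (suc k) 2                       ∎
  where open ≡-Reasoning

insets-block-zero : ∀ m n → insets m (suc n) 0 2 ≡ 2 * insets m n 0 2
insets-block-zero m n = begin
  insets m (suc n) 0 2              ≡⟨ insets-zero m (suc n) 2 ⟩
  insetsOfSize m (suc n) 2 (suc n)  ≡⟨ diagonal n ⟩
  2 * insetsOfSize m n 2 n          ≡⟨ cong (2 *_) (insets-zero m n 2) ⟨
  2 * insets m n 0 2                ∎
  where
  open ≡-Reasoning
  diagonal : ∀ n → insetsOfSize m (suc n) 2 (suc n) ≡ 2 * insetsOfSize m n 2 n
  diagonal zero    = insetsOfSize-sucⁿ-one m 0
  diagonal (suc n) = trans (insetsOfSize-sucⁿ-suc-suc m (suc n) n)
                           (cong (_+ 2 * insetsOfSize m (suc n) 2 (suc n)) (insetsOfSize-below m 2 (n<1+n n)))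

insets-excess : ∀ m n k q → n * q + m < n + k → insets m n k q ≡ 0
insets-excess m n k q n*q+m<n+k = trans (insets≡insetsOfSize m n k q) (insetsOfSize-above m n q n*q+m<n+k)

evenᵇ-suc : ∀ x → evenᵇ (suc x) ≡ not (evenᵇ x)
evenᵇ-suc zero          = refl
evenᵇ-suc (suc zero)    = refl
evenᵇ-suc (suc (suc x)) = evenᵇ-suc x

evenᵇ-2* : ∀ j → evenᵇ (2 * j) ≡ true
evenᵇ-2* zero    = refl
evenᵇ-2* (suc j) = trans (cong evenᵇ (*-suc 2 j)) (evenᵇ-2* j)

evenᵇ-2*+1 : ∀ j → evenᵇ (2 * j + 1) ≡ false
evenᵇ-2*+1 j = trans (cong evenᵇ (+-comm (2 * j) 1)) (trans (evenᵇ-suc (2 * j)) (cong not (evenᵇ-2* j)))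

suc≡2*suc⇒≡2*+1 : ∀ {x} j → suc x ≡ 2 * suc j → x ≡ 2 * j + 1
suc≡2*suc⇒≡2*+1 j e = suc-injective (trans e (trans (*-suc 2 j) (cong suc (+-comm 1 (2 * j)))))

suc≡2*+1⇒≡2* : ∀ {x} j → suc x ≡ 2 * j + 1 → x ≡ 2 * j
suc≡2*+1⇒≡2* j e = suc-injective (trans e (+-comm (2 * j) 1))

sulanke-suc-zero-even : ∀ {n} j → suc n ≡ 2 * j → sulanke (suc n) 0 ≡ sulanke n 0
sulanke-suc-zero-even {n} j e rewrite e | evenᵇ-2* j = +-identityʳ (sulanke n 0)

sulanke-suc-zero-odd : ∀ {n} j → suc n ≡ 2 * j + 1 → sulanke (suc n) 0 ≡ 2 * sulanke n 0
sulanke-suc-zero-odd {n} j e rewrite e | evenᵇ-2*+1 j = refl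

sulanke-suc-suc-even : ∀ {n k} j → suc n + suc k ≡ 2 * j →
  sulanke (suc n) (suc k) ≡ sulanke (suc n) k + sulanke n (suc k)
sulanke-suc-suc-even {n} {k} j e rewrite e | evenᵇ-2* j = cong (sulanke (suc n) k +_) (+-identityʳ _)

sulanke-suc-suc-odd : ∀ {n k} j → suc n + suc k ≡ 2 * j + 1 →
  sulanke (suc n) (suc k) ≡ sulanke (suc n) k + 2 * sulanke n (suc k)
sulanke-suc-suc-odd {n} {k} j e rewrite e | evenᵇ-2*+1 j = refl

sulanke≡insets-even : ∀ n k j → n + k ≡ 2 * j → sulanke n k ≡ insets j j k 2
sulanke≡insets-odd  : ∀ n k j → n + k ≡ 2 * j + 1 → sulanke n k ≡ insets j (suc j) k 2

sulanke≡insets-even zero    zero    zero    refl = refl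
sulanke≡insets-even zero    zero    (suc j) ()
sulanke≡insets-even zero    (suc k) zero    ()
sulanke≡insets-even (suc n) k       zero    ()
sulanke≡insets-even zero    (suc k) (suc j) e = begin
  sulanke 0 k                                         ≡⟨ sulanke≡insets-odd 0 k j (suc≡2*suc⇒≡2*+1 j e) ⟩
  insets j (suc j) k 2                                ≡⟨ +-identityʳ _ ⟨
  insets j (suc j) k 2 + 0                            ≡⟨ cong (insets j (suc j) k 2 +_) (insets-excess j (suc j) (suc k) 2 excess) ⟨
  insets j (suc j) k 2 + insets j (suc j) (suc k) 2   ≡⟨ insets-pascal j (suc j) k 2 ⟨
  insets (suc j) (suc j) (suc k) 2                    ∎
  where
  open ≡-Reasoning
  excess : suc j * 2 + j < suc j + suc k
  excess = subst (λ x → suc j * 2 + j < suc j + x) (sym e) (≤-reflexive (sizes j))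
    where
    sizes : ∀ j → suc (suc j * 2 + j) ≡ suc j + 2 * suc j
    sizes = solve-∀
sulanke≡insets-even (suc n) zero    (suc j) e = begin
  sulanke (suc n) 0            ≡⟨ sulanke-suc-zero-even (suc j) (trans (sym (+-identityʳ (suc n))) e) ⟩
  sulanke n 0                  ≡⟨ sulanke≡insets-odd n 0 j (suc≡2*suc⇒≡2*+1 j e) ⟩
  insets j (suc j) 0 2         ≡⟨ insets-pascal-zero j (suc j) 2 ⟨
  insets (suc j) (suc j) 0 2   ∎
  where open ≡-Reasoning
sulanke≡insets-even (suc n) (suc k) (suc j) e = begin
  sulanke (suc n) (suc k)                             ≡⟨ sulanke-suc-suc-even (suc j) e ⟩
  sulanke (suc n) k + sulanke n (suc k)               ≡⟨ cong₂ _+_ (sulanke≡insets-odd (suc n) k j (trans (sym (+-suc n k)) n+k′≡))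
                                                                   (sulanke≡insets-odd n (suc k) j n+k′≡) ⟩
  insets j (suc j) k 2 + insets j (suc j) (suc k) 2   ≡⟨ insets-pascal j (suc j) k 2 ⟨
  insets (suc j) (suc j) (suc k) 2                    ∎
  where
  open ≡-Reasoning
  n+k′≡ : n + suc k ≡ 2 * j + 1
  n+k′≡ = suc≡2*suc⇒≡2*+1 j e

sulanke≡insets-odd zero    zero    j e = contradiction (sym e) (m+1+n≢0 (2 * j))
sulanke≡insets-odd zero    (suc k) j e = begin
  sulanke 0 k                                 ≡⟨ sulanke≡insets-even 0 k j (suc≡2*+1⇒≡2* j e) ⟩
  insets j j k 2                              ≡⟨ +-identityʳ _ ⟨
  insets j j k 2 + 2 * 0                      ≡⟨ cong (λ x → insets j j k 2 + 2 * x) (insets-excess j j (suc k) 2 excess) ⟨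
  insets j j k 2 + 2 * insets j j (suc k) 2   ≡⟨ insets-block j j k ⟨
  insets j (suc j) (suc k) 2                  ∎
  where
  open ≡-Reasoning
  excess : j * 2 + j < j + suc k
  excess = subst (λ x → j * 2 + j < j + x) (sym e) (≤-reflexive (sizes j))
    where
    sizes : ∀ j → suc (j * 2 + j) ≡ j + (2 * j + 1)
    sizes = solve-∀
sulanke≡insets-odd (suc n) zero    j e = begin
  sulanke (suc n) 0      ≡⟨ sulanke-suc-zero-odd j (trans (sym (+-identityʳ (suc n))) e) ⟩
  2 * sulanke n 0        ≡⟨ cong (2 *_) (sulanke≡insets-even n 0 j (suc≡2*+1⇒≡2* j e)) ⟩
  2 * insets j j 0 2     ≡⟨ insets-block-zero j j ⟨
  insets j (suc j) 0 2   ∎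
  where open ≡-Reasoning
sulanke≡insets-odd (suc n) (suc k) j e = begin
  sulanke (suc n) (suc k)                     ≡⟨ sulanke-suc-suc-odd j e ⟩
  sulanke (suc n) k + 2 * sulanke n (suc k)   ≡⟨ cong₂ (λ a b → a + 2 * b)
                                                       (sulanke≡insets-even (suc n) k j (trans (sym (+-suc n k)) n+k′≡))
                                                       (sulanke≡insets-even n (suc k) j n+k′≡) ⟩
  insets j j k 2 + 2 * insets j j (suc k) 2   ≡⟨ insets-block j j k ⟨
  insets j (suc j) (suc k) 2                  ∎
  where
  open ≡-Reasoning
  n+k′≡ : n + suc k ≡ 2 * j
  n+k′≡ = suc≡2*+1⇒≡2* j e

mainTheorem10 : (n k : ℕ) →
    ((j : ℕ) → n + k ≡ 2 * j → sulanke n k ≡ insets j j k 2)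
    × ((j : ℕ) → n + k ≡ 2 * j + 1 → sulanke n k ≡ insets j (suc j) k 2)
mainTheorem10 n k = sulanke≡insets-even n k , sulanke≡insets-odd n k
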